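{- Let $G$ be a connected graph. Then $\chi_\rho''(G)=1$ if and only if $G\cong K_1$; there is no connected graph $G$ with $\chi_\rho''(G)=2$; $\chi_\rho''(G)=3$ if and only if $G\cong K_2$; and $\chi_\rho''(G)=4$ if and only if $G\cong P_3$ (the path on three vertices).
   Context: All graphs are simple, finite and undirected. The total graph $T(G)$ of a graph $G$ has vertex set $V(G)\cup E(G)$, where two elements are adjacent if they are adjacent vertices of $G$, incident edges of $G$ (sharing an endpoint), or a vertex and an edge of $G$ having that vertex as an endpoint. A packing total coloring of $G$ is a map $c:V(G)\cup E(G)\to\{1,2,\dots\}$ such that for any two distinct elements $A,B\in V(G)\cup E(G)$ with $c(A)=c(B)=i$, the distance between $A$ and $B$ in $T(G)$ is greater than $i$. The packing total chromatic number $\chi_\rho''(G)$ is the smallest $k$ such that $G$ has a packing total coloring with colors from $\{1,\dots,k\}$. -}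

module Defs where

open import Data.Nat using (ℕ; zero; suc; _≤_)
open import Data.Fin using (Fin; zero; suc; _<_)
open import Data.Fin.Properties using (_≟_)
open import Data.Bool using (Bool; true; false; not)
open import Data.Product using (Σ; _×_; _,_; ∃-syntax)
open import Data.Sum using (_⊎_; inj₁; inj₂)
open import Relation.Binary.PropositionalEquality using (_≡_; _≢_)
open import Relation.Nullary using (¬_; does)
open import Function.Bundles using (_↔_; Inverse)

record Graph : Set where
  field
    order : ℕ
    adj   : Fin order → Fin order → Bool
    sym   : ∀ u v → adj u v ≡ adj v u
    irrefl : ∀ u → adj u u ≡ false
open Graph public

data Walk (G : Graph) : Fin (order G) → Fin (order G) → ℕ → Set where
  here : ∀ {u} → Walk G u u 0
  step : ∀ {u v w k} → adj G u v ≡ true → Walk G v w k → Walk G u w (suc k)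

Connected : Graph → Set
Connected G = (1 ≤ order G) × (∀ u v → ∃[ k ] Walk G u v k)

-- Edges: unordered pairs represented as (u , v) with u < v and u ~ v
Edge : Graph → Set
Edge G = Σ (Fin (order G) × Fin (order G))
           (λ { (u , v) → (u < v) × (adj G u v ≡ true) })

endpoint : (G : Graph) → Fin (order G) → Edge G → Set
endpoint G w ((u , v) , _) = (w ≡ u) ⊎ (w ≡ v)

-- Elements of the total graph T(G): vertices and edges of G
Elem : Graph → Set
Elem G = Fin (order G) ⊎ Edge G

TAdj : (G : Graph) → Elem G → Elem G → Set
TAdj G (inj₁ u) (inj₁ v) = adj G u v ≡ true
TAdj G (inj₁ u) (inj₂ e) = endpoint G u e
TAdj G (inj₂ e) (inj₁ u) = endpoint G u e
TAdj G (inj₂ e) (inj₂ f) = (e ≢ f) × (∃[ w ] (endpoint G w e × endpoint G w f))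

data TWalk (G : Graph) : Elem G → Elem G → ℕ → Set where
  here : ∀ {a} → TWalk G a a 0
  step : ∀ {a b c k} → TAdj G a b → TWalk G b c k → TWalk G a c (suc k)

-- distance in T(G) between a and b is greater than i
-- (i.e. there is no walk of length ≤ i; includes the case of infinite distance)
DistGt : (G : Graph) → Elem G → Elem G → ℕ → Set
DistGt G a b i = ∀ k → k ≤ i → ¬ TWalk G a b k

IsPackingTotalColoring : (G : Graph) → ℕ → (Elem G → ℕ) → Set
IsPackingTotalColoring G k c =
  (∀ a → (1 ≤ c a) × (c a ≤ k)) ×
  (∀ a b → a ≢ b → c a ≡ c b → DistGt G a b (c a))

HasPackingTotalColoring : Graph → ℕ → Set
HasPackingTotalColoring G k = Σ (Elem G → ℕ) (IsPackingTotalColoring G k)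

PackingTotalChromaticNumberIs : Graph → ℕ → Set
PackingTotalChromaticNumberIs G k =
  HasPackingTotalColoring G k × (∀ j → HasPackingTotalColoring G j → k ≤ j)

_≅_ : Graph → Graph → Set
G ≅ H = Σ (Fin (order G) ↔ Fin (order H))
          (λ f → ∀ u v → adj G u v ≡ adj H (Inverse.to f u) (Inverse.to f v))

K₁ : Graph
K₁ = record { order = 1 ; adj = λ _ _ → false ; sym = λ _ _ → Relation.Binary.PropositionalEquality.refl ; irrefl = λ _ → Relation.Binary.PropositionalEquality.refl }

k2adj : Fin 2 → Fin 2 → Bool
k2adj u v = not (does (u ≟ v))

K₂ : Graph
K₂ = record { order = 2 ; adj = k2adj ; sym = s ; irrefl = i }
  where
  open Relation.Binary.PropositionalEquality using (refl)
  s : ∀ u v → k2adj u v ≡ k2adj v u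
  s zero zero = refl
  s zero (suc zero) = refl
  s (suc zero) zero = refl
  s (suc zero) (suc zero) = refl
  i : ∀ u → k2adj u u ≡ false
  i zero = refl
  i (suc zero) = refl

p3adj : Fin 3 → Fin 3 → Bool
p3adj zero (suc zero) = true
p3adj (suc zero) zero = true
p3adj (suc zero) (suc (suc zero)) = true
p3adj (suc (suc zero)) (suc zero) = true
p3adj _ _ = false

P₃ : Graph
P₃ = record { order = 3 ; adj = p3adj ; sym = s ; irrefl = i }
  where
  open Relation.Binary.PropositionalEquality using (refl)
  s : ∀ u v → p3adj u v ≡ p3adj v u
  s zero zero = refl
  s zero (suc zero) = refl
  s zero (suc (suc zero)) = refl
  s (suc zero) zero = refl
  s (suc zero) (suc zero) = refl
  s (suc zero) (suc (suc zero)) = refl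
  s (suc (suc zero)) zero = refl
  s (suc (suc zero)) (suc zero) = refl
  s (suc (suc zero)) (suc (suc zero)) = refl
  i : ∀ u → p3adj u u ≡ false
  i zero = refl
  i (suc zero) = refl
  i (suc (suc zero)) = refl

module Submission where

-- In T(G) the two ends of an edge and the edge itself are pairwise adjacent, so a single edge
-- already forces three colors, and a path u–v–w forces four. A triangle, a claw K₁,₃ and a path
-- on four vertices each force five; for these small configurations this is checked by evaluating
-- all colorings of their elements with colors 1..4 against a list of short walks between them.
-- A connected graph with at least three vertices contains a path u–v–w. If it has a packing total
-- 4-coloring, u and w are not adjacent, and a further vertex attached to {u, v, w} would create a
-- claw or a P₄; so the graph is P₃. The packing total chromatic number is invariant under
-- isomorphism (colorings pull back along injective homomorphisms), and explicit colorings give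
-- the values 1, 3, 4 for K₁, K₂, P₃, which yields all four equivalences.

open import Axiom.UniquenessOfIdentityProofs using (module Decidable⇒UIP)
open import Data.Bool using (Bool; true; false; T; _∧_)
open import Data.Bool.ListAction using (any)
open import Data.Bool.Properties using (T-∧) renaming (_≟_ to _≟𝔹_)
open import Data.Empty using (⊥; ⊥-elim)
open import Data.Fin using (Fin; zero; suc; #_; toℕ)
open import Data.Fin.Properties using (_≟_; <-cmp; <-irrelevant; <-irrefl; <-asym; toℕ-injective; all?; ¬∀⟶∃¬)
open import Data.List using (List; []; _∷_)
open import Data.List.Relation.Unary.All using (All; []; _∷_; lookupWith)
open import Data.List.Relation.Unary.Any.Properties using (any⁻)
open import Data.Nat using (ℕ; zero; suc; _+_; _≤_; _<_; z≤n; s≤s; _≡ᵇ_; _≤ᵇ_)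
open import Data.Nat.Properties
  using (≡ᵇ⇒≡; ≤ᵇ⇒≤; ≤-trans; ≤-antisym; ≤-pred; ≰⇒>; <⇒≱; _≤?_; m≤n⇒m<n∨m≡n; +-cancelˡ-≡)
open import Data.Product using (_×_; _,_; proj₁; proj₂; uncurry; ∃-syntax; ∃₂)
open import Data.Sum as Sum using (_⊎_; inj₁; inj₂)
open import Data.Sum.Properties using (inj₁-injective; inj₂-injective)
open import Data.Unit using (tt)
open import Data.Vec using (Vec; []; _∷_; lookup; map)
open import Data.Vec.Properties using (lookup-map)
import Data.Vec.Relation.Unary.All as Vec
open import Data.Vec.Relation.Unary.All.Properties using (map⁺)
open import Function using (id; _∘_)
open import Function.Bundles using (Equivalence; Inverse; Injection; _⇔_; mk⇔; mk↔ₛ′)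
open import Function.Construct.Symmetry using (↔-sym)
open import Function.Properties.Inverse using (↔⇒↣)
open import Relation.Binary.Definitions using (tri<; tri≈; tri>)
open import Relation.Binary.PropositionalEquality as ≡ using (_≡_; _≢_; refl; trans; cong; cong₂; subst)
open import Relation.Nullary using (¬_; yes; no)
open import Relation.Nullary.Decidable using (_⊎-dec_)
open import Relation.Unary using (Decidable)

open import Defs

-- Edges

module _ (G : Graph) where

  adj-sym : ∀ {u v} → adj G u v ≡ true → adj G v u ≡ true
  adj-sym {u} {v} uv = trans (sym G v u) uv

  adj⇒≢ : ∀ {u v} → adj G u v ≡ true → u ≢ v
  adj⇒≢ {u} uv refl with () ← trans (≡.sym uv) (irrefl G u)

  edge : ∀ {u v} → adj G u v ≡ true → Edge G
  edge {u} {v} uv with <-cmp u v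
  ... | tri< u<v _ _ = (u , v) , u<v , uv
  ... | tri≈ _ u≡v _ = ⊥-elim (adj⇒≢ uv u≡v)
  ... | tri> _ _ v<u = (v , u) , v<u , adj-sym uv

  endˡ : ∀ {u v} (uv : adj G u v ≡ true) → endpoint G u (edge uv)
  endˡ {u} {v} uv with <-cmp u v
  ... | tri< _ _ _ = inj₁ refl
  ... | tri≈ _ u≡v _ = ⊥-elim (adj⇒≢ uv u≡v)
  ... | tri> _ _ _ = inj₂ refl

  endʳ : ∀ {u v} (uv : adj G u v ≡ true) → endpoint G v (edge uv)
  endʳ {u} {v} uv with <-cmp u v
  ... | tri< _ _ _ = inj₂ refl
  ... | tri≈ _ u≡v _ = ⊥-elim (adj⇒≢ uv u≡v)
  ... | tri> _ _ _ = inj₁ refl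

  endpoint-edge : ∀ {u v w} (uv : adj G u v ≡ true) → endpoint G w (edge uv) → w ≡ u ⊎ w ≡ v
  endpoint-edge {u} {v} uv w∈uv with <-cmp u v
  ... | tri< _ _ _ = w∈uv
  ... | tri≈ _ u≡v _ = ⊥-elim (adj⇒≢ uv u≡v)
  ... | tri> _ _ _ = Sum.swap w∈uv

  edge-determined : (e f : Edge G) → (∀ w → endpoint G w e → endpoint G w f) → e ≡ f
  edge-determined ((p , q) , p<q , pq) ((p′ , q′) , p′<q′ , p′q′) e⊆f
    with e⊆f p (inj₁ refl) | e⊆f q (inj₂ refl)
  ... | inj₁ refl | inj₂ refl =
    cong₂ (λ lt a → (p , q) , lt , a)
          (<-irrelevant p<q p′<q′) (Decidable⇒UIP.≡-irrelevant _≟𝔹_ pq p′q′)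
  ... | inj₁ refl | inj₁ refl = ⊥-elim (<-irrefl refl p<q)
  ... | inj₂ refl | inj₂ refl = ⊥-elim (<-irrefl refl p<q)
  ... | inj₂ refl | inj₁ refl = ⊥-elim (<-asym p<q p′<q′)

  edge-≢ : ∀ {z x y e} (xy : adj G x y ≡ true) → endpoint G z e → z ≢ x → z ≢ y → e ≢ edge xy
  edge-≢ xy z∈e z≢x z≢y refl with endpoint-edge xy z∈e
  ... | inj₁ z≡x = z≢x z≡x
  ... | inj₂ z≡y = z≢y z≡y

-- Packing total colorings

module _ {G : Graph} where

  hasColoring-mono : ∀ {j k} → j ≤ k → HasPackingTotalColoring G j → HasPackingTotalColoring G k
  hasColoring-mono j≤k (c , bounded , packing) =
    c , (λ a → proj₁ (bounded a) , ≤-trans (proj₂ (bounded a)) j≤k) , packing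

  ¬hasColoring⇒< : ∀ {j k} → ¬ HasPackingTotalColoring G k → HasPackingTotalColoring G j → k < j
  ¬hasColoring⇒< {j} {k} ¬col col with suc k ≤? j
  ... | yes k<j = k<j
  ... | no k≮j = ⊥-elim (¬col (hasColoring-mono (≤-pred (≰⇒> k≮j)) col))

  chromaticNumber-intro : ∀ {k} → HasPackingTotalColoring G (suc k) → ¬ HasPackingTotalColoring G k →
                          PackingTotalChromaticNumberIs G (suc k)
  chromaticNumber-intro col ¬col = col , λ _ → ¬hasColoring⇒< ¬col

  chromaticNumber-unique : ∀ {j k} → PackingTotalChromaticNumberIs G j →
                           PackingTotalChromaticNumberIs G k → j ≡ k
  chromaticNumber-unique (colj , minj) (colk , mink) = ≤-antisym (minj _ colk) (mink _ colj)

  ¬hasColoring₀ : Fin (order G) → ¬ HasPackingTotalColoring G 0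
  ¬hasColoring₀ v (_ , bounded , _) with () ← uncurry ≤-trans (bounded (inj₁ v))

  onlyColor1Repeats⇒packing : ∀ {c : Elem G → ℕ} →
    (∀ a b → a ≢ b → c a ≡ c b → c a ≡ 1 × ¬ TAdj G a b) →
    ∀ a b → a ≢ b → c a ≡ c b → DistGt G a b (c a)
  onlyColor1Repeats⇒packing classes a b a≢b same with classes a b a≢b same
  ... | c≡1 , ¬ab rewrite c≡1 = λ where
    zero          _        here          → a≢b refl
    (suc zero)    _        (step ab here) → ¬ab ab
    (suc (suc _)) (s≤s ()) _

-- Small obstructions

-- i ~[ d ] j: the i-th and j-th of a list of elements of T(G) are distinct and joined by a walk of
-- length d, so a packing coloring cannot give both the same color c ≥ d. A list of constraints is
-- Unavoidable for m when every assignment of colors 1..m violates one of them; this is decided by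
-- evaluation. Certificates list the vertices first, then the edges, in the order used below.
infix 6 _~[_]_

record Constraint (n : ℕ) : Set where
  constructor _~[_]_
  field
    i : Fin n
    dist : ℕ
    j : Fin n

violates : ∀ {n} → Vec ℕ n → Constraint n → Bool
violates colors (i ~[ d ] j) = (lookup colors i ≡ᵇ lookup colors j) ∧ (d ≤ᵇ lookup colors i)

InRange : ℕ → ℕ → Set
InRange m x = 1 ≤ x × x ≤ m

allInRange : ℕ → (ℕ → Bool) → Bool
allInRange zero    p = true
allInRange (suc m) p = p (suc m) ∧ allInRange m p

allInRange-sound : ∀ m p {x} → T (allInRange m p) → InRange m x → T (p x)
allInRange-sound zero    p _   (s≤s _ , ())
allInRange-sound (suc m) p all (1≤x , x≤1+m) with m≤n⇒m<n∨m≡n x≤1+m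
... | inj₂ refl  = proj₁ (Equivalence.to T-∧ all)
... | inj₁ x<1+m = allInRange-sound m p (proj₂ (Equivalence.to T-∧ all)) (1≤x , ≤-pred x<1+m)

allColorings : ℕ → (n : ℕ) → (Vec ℕ n → Bool) → Bool
allColorings m zero    p = p []
allColorings m (suc n) p = allInRange m λ x → allColorings m n (p ∘ (x ∷_))

allColorings-sound : ∀ m n p → T (allColorings m n p) → ∀ v → Vec.All (InRange m) v → T (p v)
allColorings-sound m zero    p all []       Vec.[]         = all
allColorings-sound m (suc n) p all (x ∷ v) (x∈ Vec.∷ v∈) =
  allColorings-sound m n (p ∘ (x ∷_)) (allInRange-sound m _ all x∈) v v∈

Unavoidable : ∀ {n} → ℕ → List (Constraint n) → Set
Unavoidable {n} m cs = T (allColorings m n λ colors → any (violates colors) cs)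

module _ {G : Graph} where

  Realizes : ∀ {n} → Vec (Elem G) n → Constraint n → Set
  Realizes xs (i ~[ d ] j) = lookup xs i ≢ lookup xs j × TWalk G (lookup xs i) (lookup xs j) d

  realized⇒¬violated : ∀ {m n c} → IsPackingTotalColoring G m c → (xs : Vec (Elem G) n) →
                       ∀ {con} → Realizes xs con → T (violates (map c xs) con) → ⊥
  realized⇒¬violated {c = c} (_ , packing) xs {i ~[ d ] j} (a≢b , walk) clash =
    packing _ _ a≢b (subst (_≡ c b) (lookup-map i c xs) (trans same (lookup-map j c xs)))
            d (subst (d ≤_) (lookup-map i c xs) near) walk
    where
    a = lookup xs i
    b = lookup xs j
    same = ≡ᵇ⇒≡ _ _ (proj₁ (Equivalence.to T-∧ clash))
    near = ≤ᵇ⇒≤ d _ (proj₂ (Equivalence.to T-∧ clash))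

  unavoidable⇒¬hasColoring : ∀ {m n} (cs : List (Constraint n)) → Unavoidable m cs →
                             (xs : Vec (Elem G) n) → All (Realizes xs) cs → ¬ HasPackingTotalColoring G m
  unavoidable⇒¬hasColoring {m} {n} cs unavoidable xs realized (c , col) =
    lookupWith (realized⇒¬violated col xs) realized
      (any⁻ _ cs (allColorings-sound m n _ unavoidable (map c xs) (map⁺ (Vec.universal (proj₁ col) xs))))

edge-certificate : List (Constraint 3)
edge-certificate = # 0 ~[ 1 ] # 1 ∷ # 0 ~[ 1 ] # 2 ∷ # 1 ~[ 1 ] # 2 ∷ []

edge-certificate-unavoidable : Unavoidable 2 edge-certificate
edge-certificate-unavoidable = tt

path-certificate : List (Constraint 5)
path-certificate =
  # 0 ~[ 1 ] # 1 ∷ # 0 ~[ 1 ] # 3 ∷ # 0 ~[ 2 ] # 4 ∷ # 1 ~[ 1 ] # 2 ∷ # 1 ~[ 1 ] # 3 ∷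
  # 1 ~[ 1 ] # 4 ∷ # 2 ~[ 2 ] # 3 ∷ # 2 ~[ 1 ] # 4 ∷ # 3 ~[ 1 ] # 4 ∷ []

path-certificate-unavoidable : Unavoidable 3 path-certificate
path-certificate-unavoidable = tt

triangle-certificate : List (Constraint 6)
triangle-certificate =
  # 0 ~[ 1 ] # 1 ∷ # 0 ~[ 1 ] # 2 ∷ # 0 ~[ 1 ] # 3 ∷ # 0 ~[ 2 ] # 4 ∷ # 0 ~[ 1 ] # 5 ∷
  # 1 ~[ 1 ] # 2 ∷ # 1 ~[ 1 ] # 3 ∷ # 1 ~[ 1 ] # 4 ∷ # 1 ~[ 2 ] # 5 ∷ # 2 ~[ 2 ] # 3 ∷
  # 2 ~[ 1 ] # 4 ∷ # 2 ~[ 1 ] # 5 ∷ # 3 ~[ 1 ] # 4 ∷ # 3 ~[ 1 ] # 5 ∷ # 4 ~[ 1 ] # 5 ∷ []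

triangle-certificate-unavoidable : Unavoidable 4 triangle-certificate
triangle-certificate-unavoidable = tt

claw-certificate : List (Constraint 7)
claw-certificate =
  # 0 ~[ 1 ] # 1 ∷ # 0 ~[ 1 ] # 2 ∷ # 0 ~[ 1 ] # 3 ∷ # 0 ~[ 1 ] # 4 ∷ # 0 ~[ 1 ] # 5 ∷
  # 0 ~[ 1 ] # 6 ∷ # 1 ~[ 1 ] # 4 ∷ # 1 ~[ 2 ] # 5 ∷ # 1 ~[ 2 ] # 6 ∷ # 2 ~[ 2 ] # 4 ∷
  # 2 ~[ 1 ] # 5 ∷ # 2 ~[ 2 ] # 6 ∷ # 3 ~[ 2 ] # 4 ∷ # 3 ~[ 2 ] # 5 ∷ # 3 ~[ 1 ] # 6 ∷
  # 4 ~[ 1 ] # 5 ∷ # 4 ~[ 1 ] # 6 ∷ # 5 ~[ 1 ] # 6 ∷ []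

claw-certificate-unavoidable : Unavoidable 4 claw-certificate
claw-certificate-unavoidable = tt

path₄-certificate : List (Constraint 7)
path₄-certificate =
  # 0 ~[ 1 ] # 1 ∷ # 0 ~[ 2 ] # 2 ∷ # 0 ~[ 1 ] # 4 ∷ # 0 ~[ 2 ] # 5 ∷ # 1 ~[ 1 ] # 2 ∷
  # 1 ~[ 2 ] # 3 ∷ # 1 ~[ 1 ] # 4 ∷ # 1 ~[ 1 ] # 5 ∷ # 1 ~[ 2 ] # 6 ∷ # 2 ~[ 1 ] # 3 ∷
  # 2 ~[ 2 ] # 4 ∷ # 2 ~[ 1 ] # 5 ∷ # 2 ~[ 1 ] # 6 ∷ # 3 ~[ 2 ] # 5 ∷ # 3 ~[ 1 ] # 6 ∷
  # 4 ~[ 1 ] # 5 ∷ # 4 ~[ 2 ] # 6 ∷ # 5 ~[ 1 ] # 6 ∷ []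

path₄-certificate-unavoidable : Unavoidable 4 path₄-certificate
path₄-certificate-unavoidable = tt

module _ (G : Graph) where

  private
    ≢-inj₁ : ∀ {u v} → u ≢ v → _≢_ {A = Elem G} (inj₁ u) (inj₁ v)
    ≢-inj₁ u≢v = u≢v ∘ inj₁-injective

    ≢-inj₂ : ∀ {e f} → e ≢ f → _≢_ {A = Elem G} (inj₂ e) (inj₂ f)
    ≢-inj₂ e≢f = e≢f ∘ inj₂-injective

  edge⇒¬hasColoring₂ : ∀ {u v} → adj G u v ≡ true → ¬ HasPackingTotalColoring G 2
  edge⇒¬hasColoring₂ {u} {v} uv =
    unavoidable⇒¬hasColoring edge-certificate edge-certificate-unavoidable
      (inj₁ u ∷ inj₁ v ∷ inj₂ (edge G uv) ∷ [])
      ( (≢-inj₁ (adj⇒≢ G uv) , step uv here)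
      ∷ ((λ ()) , step (endˡ G uv) here)
      ∷ ((λ ()) , step (endʳ G uv) here)
      ∷ [])

  path⇒¬hasColoring₃ : ∀ {u v w} → adj G u v ≡ true → adj G v w ≡ true → u ≢ w →
                       ¬ HasPackingTotalColoring G 3
  path⇒¬hasColoring₃ {u} {v} {w} uv vw u≢w =
    unavoidable⇒¬hasColoring path-certificate path-certificate-unavoidable
      (inj₁ u ∷ inj₁ v ∷ inj₁ w ∷ inj₂ a ∷ inj₂ b ∷ [])
      ( (≢-inj₁ (adj⇒≢ G uv) , step uv here)
      ∷ ((λ ()) , step (endˡ G uv) here)
      ∷ ((λ ()) , step uv (step (endˡ G vw) here))
      ∷ (≢-inj₁ (adj⇒≢ G vw) , step vw here)
      ∷ ((λ ()) , step (endʳ G uv) here)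
      ∷ ((λ ()) , step (endˡ G vw) here)
      ∷ ((λ ()) , step (adj-sym G vw) (step (endʳ G uv) here))
      ∷ ((λ ()) , step (endʳ G vw) here)
      ∷ (≢-inj₂ a≢b , step (a≢b , v , endʳ G uv , endˡ G vw) here)
      ∷ [])
    where
    a = edge G uv
    b = edge G vw
    a≢b = edge-≢ G vw (endˡ G uv) (adj⇒≢ G uv) u≢w

  triangle⇒¬hasColoring₄ : ∀ {u v w} → adj G u v ≡ true → adj G v w ≡ true → adj G u w ≡ true →
                           ¬ HasPackingTotalColoring G 4
  triangle⇒¬hasColoring₄ {u} {v} {w} uv vw uw =
    unavoidable⇒¬hasColoring triangle-certificate triangle-certificate-unavoidable
      (inj₁ u ∷ inj₁ v ∷ inj₁ w ∷ inj₂ a ∷ inj₂ b ∷ inj₂ c ∷ [])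
      ( (≢-inj₁ u≢v , step uv here)
      ∷ (≢-inj₁ u≢w , step uw here)
      ∷ ((λ ()) , step (endˡ G uv) here)
      ∷ ((λ ()) , step uv (step (endˡ G vw) here))
      ∷ ((λ ()) , step (endˡ G uw) here)
      ∷ (≢-inj₁ (adj⇒≢ G vw) , step vw here)
      ∷ ((λ ()) , step (endʳ G uv) here)
      ∷ ((λ ()) , step (endˡ G vw) here)
      ∷ ((λ ()) , step (adj-sym G uv) (step (endˡ G uw) here))
      ∷ ((λ ()) , step (adj-sym G vw) (step (endʳ G uv) here))
      ∷ ((λ ()) , step (endʳ G vw) here)
      ∷ ((λ ()) , step (endʳ G uw) here)
      ∷ (≢-inj₂ a≢b , step (a≢b , v , endʳ G uv , endˡ G vw) here)
      ∷ (≢-inj₂ a≢c , step (a≢c , u , endˡ G uv , endˡ G uw) here)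
      ∷ (≢-inj₂ b≢c , step (b≢c , w , endʳ G vw , endʳ G uw) here)
      ∷ [])
    where
    a = edge G uv
    b = edge G vw
    c = edge G uw
    u≢v = adj⇒≢ G uv
    u≢w = adj⇒≢ G uw
    a≢b = edge-≢ G vw (endˡ G uv) u≢v u≢w
    a≢c = edge-≢ G uw (endʳ G uv) (u≢v ∘ ≡.sym) (adj⇒≢ G vw)
    b≢c = edge-≢ G uw (endˡ G vw) (u≢v ∘ ≡.sym) (adj⇒≢ G vw)

  claw⇒¬hasColoring₄ : ∀ {o x y z} → adj G o x ≡ true → adj G o y ≡ true → adj G o z ≡ true →
                       x ≢ y → x ≢ z → y ≢ z → ¬ HasPackingTotalColoring G 4
  claw⇒¬hasColoring₄ {o} {x} {y} {z} ox oy oz x≢y x≢z y≢z =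
    unavoidable⇒¬hasColoring claw-certificate claw-certificate-unavoidable
      (inj₁ o ∷ inj₁ x ∷ inj₁ y ∷ inj₁ z ∷ inj₂ a ∷ inj₂ b ∷ inj₂ c ∷ [])
      ( (≢-inj₁ (adj⇒≢ G ox) , step ox here)
      ∷ (≢-inj₁ (adj⇒≢ G oy) , step oy here)
      ∷ (≢-inj₁ (adj⇒≢ G oz) , step oz here)
      ∷ ((λ ()) , step (endˡ G ox) here)
      ∷ ((λ ()) , step (endˡ G oy) here)
      ∷ ((λ ()) , step (endˡ G oz) here)
      ∷ ((λ ()) , step (endʳ G ox) here)
      ∷ ((λ ()) , step (adj-sym G ox) (step (endˡ G oy) here))
      ∷ ((λ ()) , step (adj-sym G ox) (step (endˡ G oz) here))
      ∷ ((λ ()) , step (adj-sym G oy) (step (endˡ G ox) here))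
      ∷ ((λ ()) , step (endʳ G oy) here)
      ∷ ((λ ()) , step (adj-sym G oy) (step (endˡ G oz) here))
      ∷ ((λ ()) , step (adj-sym G oz) (step (endˡ G ox) here))
      ∷ ((λ ()) , step (adj-sym G oz) (step (endˡ G oy) here))
      ∷ ((λ ()) , step (endʳ G oz) here)
      ∷ (≢-inj₂ a≢b , step (a≢b , o , endˡ G ox , endˡ G oy) here)
      ∷ (≢-inj₂ a≢c , step (a≢c , o , endˡ G ox , endˡ G oz) here)
      ∷ (≢-inj₂ b≢c , step (b≢c , o , endˡ G oy , endˡ G oz) here)
      ∷ [])
    where
    a = edge G ox
    b = edge G oy
    c = edge G oz
    a≢b = edge-≢ G oy (endʳ G ox) (adj⇒≢ G ox ∘ ≡.sym) x≢y
    a≢c = edge-≢ G oz (endʳ G ox) (adj⇒≢ G ox ∘ ≡.sym) x≢z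
    b≢c = edge-≢ G oz (endʳ G oy) (adj⇒≢ G oy ∘ ≡.sym) y≢z

  path₄⇒¬hasColoring₄ : ∀ {x u v w} → adj G x u ≡ true → adj G u v ≡ true → adj G v w ≡ true →
                        x ≢ v → x ≢ w → u ≢ w → ¬ HasPackingTotalColoring G 4
  path₄⇒¬hasColoring₄ {x} {u} {v} {w} xu uv vw x≢v x≢w u≢w =
    unavoidable⇒¬hasColoring path₄-certificate path₄-certificate-unavoidable
      (inj₁ x ∷ inj₁ u ∷ inj₁ v ∷ inj₁ w ∷ inj₂ a ∷ inj₂ b ∷ inj₂ c ∷ [])
      ( (≢-inj₁ x≢u , step xu here)
      ∷ (≢-inj₁ x≢v , step xu (step uv here))
      ∷ ((λ ()) , step (endˡ G xu) here)
      ∷ ((λ ()) , step xu (step (endˡ G uv) here))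
      ∷ (≢-inj₁ u≢v , step uv here)
      ∷ (≢-inj₁ u≢w , step uv (step vw here))
      ∷ ((λ ()) , step (endʳ G xu) here)
      ∷ ((λ ()) , step (endˡ G uv) here)
      ∷ ((λ ()) , step uv (step (endˡ G vw) here))
      ∷ (≢-inj₁ (adj⇒≢ G vw) , step vw here)
      ∷ ((λ ()) , step (adj-sym G uv) (step (endʳ G xu) here))
      ∷ ((λ ()) , step (endʳ G uv) here)
      ∷ ((λ ()) , step (endˡ G vw) here)
      ∷ ((λ ()) , step (adj-sym G vw) (step (endʳ G uv) here))
      ∷ ((λ ()) , step (endʳ G vw) here)
      ∷ (≢-inj₂ a≢b , step a~b here)
      ∷ (≢-inj₂ a≢c , step a~b (step b~c here))
      ∷ (≢-inj₂ b≢c , step b~c here)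
      ∷ [])
    where
    a = edge G xu
    b = edge G uv
    c = edge G vw
    x≢u = adj⇒≢ G xu
    u≢v = adj⇒≢ G uv
    a≢b = edge-≢ G uv (endˡ G xu) x≢u x≢v
    a≢c = edge-≢ G vw (endˡ G xu) x≢v x≢w
    b≢c = edge-≢ G vw (endˡ G uv) u≢v u≢w
    a~b : TAdj G (inj₂ a) (inj₂ b)
    a~b = a≢b , u , endʳ G xu , endˡ G uv
    b~c : TAdj G (inj₂ b) (inj₂ c)
    b~c = b≢c , v , endʳ G uv , endˡ G vw

-- Isomorphism invariance

module Embedding {G H : Graph} (φ : Fin (order G) → Fin (order H))
                 (φ-injective : ∀ {x y} → φ x ≡ φ y → x ≡ y)
                 (φ-adj : ∀ {x y} → adj G x y ≡ true → adj H (φ x) (φ y) ≡ true) where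

  edgeMap : Edge G → Edge H
  edgeMap (_ , _ , xy) = edge H (φ-adj xy)

  endpoint-edgeMap : ∀ {w} e → endpoint G w e → endpoint H (φ w) (edgeMap e)
  endpoint-edgeMap (_ , _ , xy) (inj₁ refl) = endˡ H (φ-adj xy)
  endpoint-edgeMap (_ , _ , xy) (inj₂ refl) = endʳ H (φ-adj xy)

  edgeMap-injective : ∀ e f → edgeMap e ≡ edgeMap f → e ≡ f
  edgeMap-injective e f@(_ , _ , xy) eq = edge-determined G e f λ w w∈e →
    Sum.map φ-injective φ-injective
      (endpoint-edge H (φ-adj xy) (subst (endpoint H (φ w)) eq (endpoint-edgeMap e w∈e)))

  elemMap : Elem G → Elem H
  elemMap = Sum.map φ edgeMap

  elemMap-injective : ∀ {a b} → elemMap a ≡ elemMap b → a ≡ b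
  elemMap-injective {inj₁ x} {inj₁ y} eq = cong inj₁ (φ-injective (inj₁-injective eq))
  elemMap-injective {inj₂ e} {inj₂ f} eq = cong inj₂ (edgeMap-injective e f (inj₂-injective eq))

  TAdj-map : ∀ {a b} → TAdj G a b → TAdj H (elemMap a) (elemMap b)
  TAdj-map {inj₁ x} {inj₁ y} xy = φ-adj xy
  TAdj-map {inj₁ x} {inj₂ e} x∈e = endpoint-edgeMap e x∈e
  TAdj-map {inj₂ e} {inj₁ x} x∈e = endpoint-edgeMap e x∈e
  TAdj-map {inj₂ e} {inj₂ f} (e≢f , w , w∈e , w∈f) =
    e≢f ∘ edgeMap-injective e f , φ w , endpoint-edgeMap e w∈e , endpoint-edgeMap f w∈f

  TWalk-map : ∀ {a b k} → TWalk G a b k → TWalk H (elemMap a) (elemMap b) k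
  TWalk-map here          = here
  TWalk-map (step ab walk) = step (TAdj-map ab) (TWalk-map walk)

  hasColoring-pullback : ∀ {k} → HasPackingTotalColoring H k → HasPackingTotalColoring G k
  hasColoring-pullback (c , bounded , packing) =
    c ∘ elemMap , bounded ∘ elemMap ,
    λ a b a≢b same d d≤ walk → packing _ _ (a≢b ∘ elemMap-injective) same d d≤ (TWalk-map walk)

≅-sym : ∀ {G H} → G ≅ H → H ≅ G
≅-sym {G} {H} (f , adj≡) = ↔-sym f , λ u v →
  ≡.sym (trans (adj≡ (from u) (from v)) (cong₂ (adj H) (strictlyInverseˡ u) (strictlyInverseˡ v)))
  where open Inverse f

≅⇒hasColoring : ∀ {G H k} → G ≅ H → HasPackingTotalColoring H k → HasPackingTotalColoring G k
≅⇒hasColoring (f , adj≡) = Embedding.hasColoring-pullback (Inverse.to f) (Injection.injective (↔⇒↣ f))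
  λ {x} {y} xy → trans (≡.sym (adj≡ x y)) xy

chromaticNumber-≅ : ∀ {G H k} → G ≅ H →
                    PackingTotalChromaticNumberIs H k → PackingTotalChromaticNumberIs G k
chromaticNumber-≅ {G} {H} G≅H (col , minimal) =
  ≅⇒hasColoring {G} {H} G≅H col , λ j → minimal j ∘ ≅⇒hasColoring {H} {G} (≅-sym {G} {H} G≅H)

-- K₁, K₂ and P₃

K₁-no-edge : ¬ Edge K₁
K₁-no-edge ((zero , zero) , () , _)

K₁-coloring : HasPackingTotalColoring K₁ 1
K₁-coloring = (λ _ → 1) , (λ _ → s≤s z≤n , s≤s z≤n) , onlyColor1Repeats⇒packing classes
  where
  classes : ∀ a b → a ≢ b → 1 ≡ 1 → 1 ≡ 1 × ¬ TAdj K₁ a b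
  classes (inj₁ zero) (inj₁ zero) a≢b _ = ⊥-elim (a≢b refl)
  classes (inj₂ e)    _           _   _ = ⊥-elim (K₁-no-edge e)
  classes _           (inj₂ e)    _   _ = ⊥-elim (K₁-no-edge e)

K₂-edge : (e : Edge K₂) → e ≡ ((zero , suc zero) , s≤s z≤n , refl)
K₂-edge ((zero , suc zero) , s≤s z≤n , refl) = refl
K₂-edge ((zero , zero) , () , _)
K₂-edge ((suc zero , zero) , () , _)
K₂-edge ((suc zero , suc zero) , s≤s () , _)

K₂-coloring : HasPackingTotalColoring K₂ 3
K₂-coloring = c , bounded , onlyColor1Repeats⇒packing classes
  where
  c : Elem K₂ → ℕ
  c (inj₁ zero)       = 1
  c (inj₁ (suc zero)) = 2
  c (inj₂ _)          = 3
  bounded : ∀ a → 1 ≤ c a × c a ≤ 3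
  bounded (inj₁ zero)       = s≤s z≤n , s≤s z≤n
  bounded (inj₁ (suc zero)) = s≤s z≤n , s≤s (s≤s z≤n)
  bounded (inj₂ _)          = s≤s z≤n , s≤s (s≤s (s≤s z≤n))
  classes : ∀ a b → a ≢ b → c a ≡ c b → c a ≡ 1 × ¬ TAdj K₂ a b
  classes (inj₁ zero)       (inj₁ zero)       a≢b _ = ⊥-elim (a≢b refl)
  classes (inj₁ (suc zero)) (inj₁ (suc zero)) a≢b _ = ⊥-elim (a≢b refl)
  classes (inj₂ e)          (inj₂ f)          a≢b _ =
    ⊥-elim (a≢b (cong inj₂ (trans (K₂-edge e) (≡.sym (K₂-edge f)))))
  classes (inj₁ zero)       (inj₁ (suc zero)) _ ()
  classes (inj₁ (suc zero)) (inj₁ zero)       _ ()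
  classes (inj₁ zero)       (inj₂ _)          _ ()
  classes (inj₁ (suc zero)) (inj₂ _)          _ ()
  classes (inj₂ _)          (inj₁ zero)       _ ()
  classes (inj₂ _)          (inj₁ (suc zero)) _ ()

P₃-edge : (e : Edge P₃) → e ≡ ((zero , suc zero) , s≤s z≤n , refl)
                        ⊎ e ≡ ((suc zero , suc (suc zero)) , s≤s (s≤s z≤n) , refl)
P₃-edge ((zero , suc zero) , s≤s z≤n , refl) = inj₁ refl
P₃-edge ((suc zero , suc (suc zero)) , s≤s (s≤s z≤n) , refl) = inj₂ refl
P₃-edge ((zero , zero) , () , _)
P₃-edge ((zero , suc (suc zero)) , _ , ())
P₃-edge ((suc zero , zero) , () , _)
P₃-edge ((suc zero , suc zero) , s≤s () , _)
P₃-edge ((suc (suc zero) , zero) , () , _)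
P₃-edge ((suc (suc zero) , suc zero) , s≤s () , _)
P₃-edge ((suc (suc zero) , suc (suc zero)) , s≤s (s≤s ()) , _)

P₃-edge-by-first : (e f : Edge P₃) → proj₁ (proj₁ e) ≡ proj₁ (proj₁ f) → e ≡ f
P₃-edge-by-first e f same with P₃-edge e | P₃-edge f
... | inj₁ refl | inj₁ refl = refl
... | inj₂ refl | inj₂ refl = refl
... | inj₁ refl | inj₂ refl with () ← same
... | inj₂ refl | inj₁ refl with () ← same

P₃-coloring : HasPackingTotalColoring P₃ 4
P₃-coloring = c , bounded , onlyColor1Repeats⇒packing classes
  where
  c : Elem P₃ → ℕ
  c (inj₁ zero)             = 1
  c (inj₁ (suc zero))       = 2
  c (inj₁ (suc (suc zero))) = 1
  c (inj₂ ((p , _) , _))    = 3 + toℕ p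
  bounded : ∀ a → 1 ≤ c a × c a ≤ 4
  bounded (inj₁ zero)             = s≤s z≤n , s≤s z≤n
  bounded (inj₁ (suc zero))       = s≤s z≤n , s≤s (s≤s z≤n)
  bounded (inj₁ (suc (suc zero))) = s≤s z≤n , s≤s z≤n
  bounded (inj₂ e) with P₃-edge e
  ... | inj₁ refl = s≤s z≤n , s≤s (s≤s (s≤s z≤n))
  ... | inj₂ refl = s≤s z≤n , s≤s (s≤s (s≤s (s≤s z≤n)))
  classes : ∀ a b → a ≢ b → c a ≡ c b → c a ≡ 1 × ¬ TAdj P₃ a b
  classes (inj₁ zero)             (inj₁ zero)             a≢b _ = ⊥-elim (a≢b refl)
  classes (inj₁ (suc zero))       (inj₁ (suc zero))       a≢b _ = ⊥-elim (a≢b refl)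
  classes (inj₁ (suc (suc zero))) (inj₁ (suc (suc zero))) a≢b _ = ⊥-elim (a≢b refl)
  classes (inj₁ zero)             (inj₁ (suc (suc zero))) _   _ = refl , λ ()
  classes (inj₁ (suc (suc zero))) (inj₁ zero)             _   _ = refl , λ ()
  classes (inj₂ e) (inj₂ f) a≢b same =
    ⊥-elim (a≢b (cong inj₂ (P₃-edge-by-first e f (toℕ-injective (+-cancelˡ-≡ 3 _ _ same)))))
  classes (inj₁ zero)             (inj₁ (suc zero))       _ ()
  classes (inj₁ (suc zero))       (inj₁ zero)             _ ()
  classes (inj₁ (suc zero))       (inj₁ (suc (suc zero))) _ ()
  classes (inj₁ (suc (suc zero))) (inj₁ (suc zero))       _ ()
  classes (inj₁ zero)             (inj₂ _)                _ ()
  classes (inj₁ (suc zero))       (inj₂ _)                _ ()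
  classes (inj₁ (suc (suc zero))) (inj₂ _)                _ ()
  classes (inj₂ _)                (inj₁ zero)             _ ()
  classes (inj₂ _)                (inj₁ (suc zero))       _ ()
  classes (inj₂ _)                (inj₁ (suc (suc zero))) _ ()

χ-K₁ : PackingTotalChromaticNumberIs K₁ 1
χ-K₁ = chromaticNumber-intro K₁-coloring (¬hasColoring₀ zero)

χ-K₂ : PackingTotalChromaticNumberIs K₂ 3
χ-K₂ = chromaticNumber-intro K₂-coloring (edge⇒¬hasColoring₂ K₂ {zero} {suc zero} refl)

χ-P₃ : PackingTotalChromaticNumberIs P₃ 4
χ-P₃ = chromaticNumber-intro P₃-coloring
         (path⇒¬hasColoring₃ P₃ {zero} {suc zero} {suc (suc zero)} refl refl λ ())

-- Connected graphs

enumeration⇒≅ : ∀ {G} (H : Graph) (f : Fin (order H) → Fin (order G)) →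
                (∀ {i j} → f i ≡ f j → i ≡ j) → (∀ x → ∃[ i ] f i ≡ x) →
                (∀ i j → adj H i j ≡ adj G (f i) (f j)) → G ≅ H
enumeration⇒≅ {G} H f f-injective f-surjective adj≡ =
  mk↔ₛ′ g f (λ i → f-injective (section (f i))) section ,
  λ x y → ≡.sym (trans (adj≡ (g x) (g y)) (cong₂ (adj G) (section x) (section y)))
  where
  g = proj₁ ∘ f-surjective
  section = proj₂ ∘ f-surjective

avoiding-two : ∀ {n} {x₀ x₁ x₂ : Fin n} → x₀ ≢ x₁ → x₀ ≢ x₂ → x₁ ≢ x₂ →
               ∀ a → ∃[ b ] ¬ (b ≡ x₀ ⊎ b ≡ a)
avoiding-two {x₁ = x₁} {x₂} x₀≢x₁ x₀≢x₂ x₁≢x₂ a with x₁ ≟ a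
... | no  x₁≢a = x₁ , Sum.[ x₀≢x₁ ∘ ≡.sym , x₁≢a ]
... | yes refl = x₂ , Sum.[ x₀≢x₂ ∘ ≡.sym , x₁≢x₂ ∘ ≡.sym ]

module _ (G : Graph) where

  crossing-edge : (P : Fin (order G) → Set) → Decidable P → ∀ {x y k} → ¬ P x → P y → Walk G x y k →
                  ∃₂ λ a b → ¬ P a × P b × adj G a b ≡ true
  crossing-edge P P? ¬Px Py here = ⊥-elim (¬Px Py)
  crossing-edge P P? ¬Px Py (step {v = z} xz walk) with P? z
  ... | yes Pz  = _ , z , ¬Px , Pz , xz
  ... | no  ¬Pz = crossing-edge P P? ¬Pz Py walk

  neighbour : ∀ {x y k} → x ≢ y → Walk G x y k → ∃[ a ] adj G x a ≡ true
  neighbour x≢y here       = ⊥-elim (x≢y refl)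
  neighbour _   (step xa _) = _ , xa

  record Path₃ : Set where
    constructor path₃
    field
      {u v w} : Fin (order G)
      uv      : adj G u v ≡ true
      vw      : adj G v w ≡ true
      u≢w     : u ≢ w

  three-vertices⇒path₃ : Connected G → ∀ {x₀ x₁ x₂} → x₀ ≢ x₁ → x₀ ≢ x₂ → x₁ ≢ x₂ → Path₃
  three-vertices⇒path₃ (_ , connected) {x₀} {x₁} {x₂} x₀≢x₁ x₀≢x₂ x₁≢x₂
    with neighbour x₀≢x₁ (proj₂ (connected x₀ x₁))
  ... | a , x₀a with avoiding-two x₀≢x₁ x₀≢x₂ x₁≢x₂ a
  ...   | b , b∉ with crossing-edge (λ z → z ≡ x₀ ⊎ z ≡ a) (λ z → z ≟ x₀ ⊎-dec z ≟ a) b∉ (inj₁ refl)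
                                    (proj₂ (connected b x₀))
  ...     | y , _ , y∉ , inj₁ refl , yx₀ = path₃ yx₀ x₀a (y∉ ∘ inj₂)
  ...     | y , _ , y∉ , inj₂ refl , ay  = path₃ x₀a (adj-sym G ay) (y∉ ∘ inj₁ ∘ ≡.sym)

  module _ {u v w} (uv : adj G u v ≡ true) (vw : adj G v w ≡ true) (u≢w : u ≢ w) where

    Among : Fin (order G) → Set
    Among x = x ≡ u ⊎ x ≡ v ⊎ x ≡ w

    among? : Decidable Among
    among? x = x ≟ u ⊎-dec x ≟ v ⊎-dec x ≟ w

    covered⇒≅P₃ : adj G u w ≡ false → (∀ x → Among x) → G ≅ P₃
    covered⇒≅P₃ uw covered = enumeration⇒≅ {G} P₃ f f-injective f-surjective adj≡
      where
      f : Fin 3 → Fin (order G)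
      f zero             = u
      f (suc zero)       = v
      f (suc (suc zero)) = w
      f-injective : ∀ {i j} → f i ≡ f j → i ≡ j
      f-injective {zero}             {zero}             _ = refl
      f-injective {suc zero}         {suc zero}         _ = refl
      f-injective {suc (suc zero)}   {suc (suc zero)}   _ = refl
      f-injective {zero}             {suc zero}         eq = ⊥-elim (adj⇒≢ G uv eq)
      f-injective {zero}             {suc (suc zero)}   eq = ⊥-elim (u≢w eq)
      f-injective {suc zero}         {zero}             eq = ⊥-elim (adj⇒≢ G uv (≡.sym eq))
      f-injective {suc zero}         {suc (suc zero)}   eq = ⊥-elim (adj⇒≢ G vw eq)
      f-injective {suc (suc zero)}   {zero}             eq = ⊥-elim (u≢w (≡.sym eq))
      f-injective {suc (suc zero)}   {suc zero}         eq = ⊥-elim (adj⇒≢ G vw (≡.sym eq))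
      f-surjective : ∀ x → ∃[ i ] f i ≡ x
      f-surjective x with covered x
      ... | inj₁ refl        = zero , refl
      ... | inj₂ (inj₁ refl) = suc zero , refl
      ... | inj₂ (inj₂ refl) = suc (suc zero) , refl
      adj≡ : ∀ i j → p3adj i j ≡ adj G (f i) (f j)
      adj≡ zero             zero             = ≡.sym (irrefl G u)
      adj≡ zero             (suc zero)       = ≡.sym uv
      adj≡ zero             (suc (suc zero)) = ≡.sym uw
      adj≡ (suc zero)       zero             = ≡.sym (adj-sym G uv)
      adj≡ (suc zero)       (suc zero)       = ≡.sym (irrefl G v)
      adj≡ (suc zero)       (suc (suc zero)) = ≡.sym vw
      adj≡ (suc (suc zero)) zero             = ≡.sym (trans (sym G w u) uw)
      adj≡ (suc (suc zero)) (suc zero)       = ≡.sym (adj-sym G vw)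
      adj≡ (suc (suc zero)) (suc (suc zero)) = ≡.sym (irrefl G w)

    attached⇒¬hasColoring₄ : ∀ {y z} → ¬ Among y → Among z → adj G y z ≡ true →
                             ¬ HasPackingTotalColoring G 4
    attached⇒¬hasColoring₄ y∉ (inj₁ refl) yu =
      path₄⇒¬hasColoring₄ G yu uv vw (y∉ ∘ inj₂ ∘ inj₁) (y∉ ∘ inj₂ ∘ inj₂) u≢w
    attached⇒¬hasColoring₄ y∉ (inj₂ (inj₁ refl)) yv =
      claw⇒¬hasColoring₄ G (adj-sym G uv) vw (adj-sym G yv)
                         u≢w (y∉ ∘ inj₁ ∘ ≡.sym) (y∉ ∘ inj₂ ∘ inj₂ ∘ ≡.sym)
    attached⇒¬hasColoring₄ y∉ (inj₂ (inj₂ refl)) yw =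
      path₄⇒¬hasColoring₄ G yw (adj-sym G vw) (adj-sym G uv) (y∉ ∘ inj₂ ∘ inj₁) (y∉ ∘ inj₁) (u≢w ∘ ≡.sym)

    path₃⇒≅P₃⊎¬hasColoring₄ : Connected G → G ≅ P₃ ⊎ ¬ HasPackingTotalColoring G 4
    path₃⇒≅P₃⊎¬hasColoring₄ (_ , connected) with adj G u w in uw | all? among?
    ... | true  | _          = inj₂ (triangle⇒¬hasColoring₄ G uv vw uw)
    ... | false | yes covered = inj₁ (covered⇒≅P₃ uw covered)
    ... | false | no ¬covered with ¬∀⟶∃¬ _ Among among? ¬covered
    ...   | x , x∉ with crossing-edge Among among? x∉ (inj₁ refl) (proj₂ (connected x u))
    ...     | _ , _ , y∉ , z∈ , yz = inj₂ (attached⇒¬hasColoring₄ y∉ z∈ yz)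

-- The connected graphs with packing total chromatic number k ≤ 4.
data Exceptional : ℕ → Graph → Set where
  isK₁ : Exceptional 1 K₁
  isK₂ : Exceptional 3 K₂
  isP₃ : Exceptional 4 P₃

exceptional-chromaticNumber : ∀ {k H} → Exceptional k H → PackingTotalChromaticNumberIs H k
exceptional-chromaticNumber isK₁ = χ-K₁
exceptional-chromaticNumber isK₂ = χ-K₂
exceptional-chromaticNumber isP₃ = χ-P₃

exceptional-≤4 : ∀ {k H} → Exceptional k H → k ≤ 4
exceptional-≤4 isK₁ = s≤s z≤n
exceptional-≤4 isK₂ = s≤s (s≤s (s≤s z≤n))
exceptional-≤4 isP₃ = s≤s (s≤s (s≤s (s≤s z≤n)))

exceptional-functional : ∀ {k H H′} → Exceptional k H → Exceptional k H′ → H ≡ H′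
exceptional-functional isK₁ isK₁ = refl
exceptional-functional isK₂ isK₂ = refl
exceptional-functional isP₃ isP₃ = refl

classify : (G : Graph) → Connected G →
           (∃₂ λ k H → Exceptional k H × G ≅ H) ⊎ ¬ HasPackingTotalColoring G 4
classify record { order = zero } (() , _)
classify G@record { order = 1 } _ =
  inj₁ (_ , _ , isK₁ , enumeration⇒≅ {G} K₁ id id (_, refl) λ { zero zero → ≡.sym (irrefl G zero) })
classify G@record { order = 2 } (_ , connected) =
  inj₁ (_ , _ , isK₂ , enumeration⇒≅ {G} K₂ id id (_, refl) adj≡)
  where
  01-adjacent : adj G zero (suc zero) ≡ true
  01-adjacent with neighbour G (λ ()) (proj₂ (connected zero (suc zero)))
  ... | zero     , loop with () ← trans (≡.sym loop) (irrefl G zero)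
  ... | suc zero , edge01 = edge01
  adj≡ : ∀ i j → k2adj i j ≡ adj G i j
  adj≡ zero       zero       = ≡.sym (irrefl G zero)
  adj≡ zero       (suc zero) = ≡.sym 01-adjacent
  adj≡ (suc zero) zero       = ≡.sym (adj-sym G 01-adjacent)
  adj≡ (suc zero) (suc zero) = ≡.sym (irrefl G (suc zero))
classify G@record { order = suc (suc (suc _)) } connected
  with three-vertices⇒path₃ G connected {zero} {suc zero} {suc (suc zero)} (λ ()) (λ ()) (λ ())
... | path₃ uv vw u≢w with path₃⇒≅P₃⊎¬hasColoring₄ G uv vw u≢w connected
...   | inj₁ G≅P₃   = inj₁ (_ , _ , isP₃ , G≅P₃)
...   | inj₂ ¬col₄  = inj₂ ¬col₄

module _ {G : Graph} (connected : Connected G) where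

  chromaticNumber-cases : ∀ {k} → PackingTotalChromaticNumberIs G k →
                          (∃[ H ] Exceptional k H × G ≅ H) ⊎ 4 < k
  chromaticNumber-cases χ with classify G connected
  ... | inj₁ (_ , H , ex , G≅H)
    with refl ← chromaticNumber-unique χ (chromaticNumber-≅ {G} {H} G≅H (exceptional-chromaticNumber ex))
    = inj₁ (H , ex , G≅H)
  ... | inj₂ ¬col₄ = inj₂ (¬hasColoring⇒< ¬col₄ (proj₁ χ))

  chromaticNumber-exceptional : ∀ {k H} → Exceptional k H → PackingTotalChromaticNumberIs G k ⇔ G ≅ H
  chromaticNumber-exceptional {k} {H} ex =
    mk⇔ to λ G≅H → chromaticNumber-≅ {G} {H} G≅H (exceptional-chromaticNumber ex)
    where
    to : PackingTotalChromaticNumberIs G k → G ≅ H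
    to χ with chromaticNumber-cases χ
    ... | inj₁ (_ , ex′ , G≅H′) = subst (G ≅_) (≡.sym (exceptional-functional ex ex′)) G≅H′
    ... | inj₂ 4<k = ⊥-elim (<⇒≱ 4<k (exceptional-≤4 ex))

  chromaticNumber≢2 : ¬ PackingTotalChromaticNumberIs G 2
  chromaticNumber≢2 χ with chromaticNumber-cases χ
  ... | inj₁ (_ , () , _)
  ... | inj₂ (s≤s (s≤s ()))

mainTheorem8 : (G : Graph) → Connected G →
    (PackingTotalChromaticNumberIs G 1 ⇔ (G ≅ K₁)) ×
    (¬ PackingTotalChromaticNumberIs G 2) ×
    (PackingTotalChromaticNumberIs G 3 ⇔ (G ≅ K₂)) ×
    (PackingTotalChromaticNumberIs G 4 ⇔ (G ≅ P₃))
mainTheorem8 G connected =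
  chromaticNumber-exceptional connected isK₁ , chromaticNumber≢2 connected ,
  chromaticNumber-exceptional connected isK₂ , chromaticNumber-exceptional connected isP₃
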